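{- Let $K$ be a field of characteristic $0$, $a(z),b(z)\in K[z]$, $c(z)\in K(z)$ with $a(z)c(z)\ne0$. Let $w(z)$ be a nonzero element of some differential field extension $\mathcal K$ of $K(z)$ with $(-a(z)\partial_z+b(z))\cdot w(z)=0$, and let $n$ be a nonnegative integer. Put $R_n=\frac1{n!}\left(\partial_z+\frac{b(z)}{a(z)}\right)^nc(z)^n\in K(z)[\partial_z]$. Then in $\mathcal K[\partial_z]$, $$R_n=\frac1{n!}w(z)^{ -1}\partial_z^n\,w(z)c(z)^n=\frac1{n!}R_1(R_1+c'(z))\cdots(R_1+(n-1)c'(z)),$$ where $c'=\partial_z\cdot c$.
   Context: Products are compositions of differential operators; functions act by multiplication. -}

module Defs where

open import Level using (Level; _⊔_) renaming (suc to lsuc)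
open import Data.Nat using (ℕ; zero; suc; _!)

open import Data.List using (List; []; _∷_)
open import Data.List.Relation.Unary.Any using (Any)
open import Relation.Nullary using (¬_)
open import Algebra.Bundles using (CommutativeRing)
open import Algebra.Morphism.Structures using (module RingMorphisms)

-- The inverse is a total operation whose
-- value at 0 is unspecified (only x * x ⁻¹ ≈ 1 for x ≉ 0 is required).
record Field (c ℓ : Level) : Set (lsuc (c ⊔ ℓ)) where
  field
    commutativeRing : CommutativeRing c ℓ
  open CommutativeRing commutativeRing public
  field
    _⁻¹       : Carrier → Carrier
    ⁻¹-cong   : ∀ {x y} → x ≈ y → x ⁻¹ ≈ y ⁻¹
    ⁻¹-inverse : ∀ x → ¬ (x ≈ 0#) → x * x ⁻¹ ≈ 1#
    1≉0       : ¬ (1# ≈ 0#)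

  fromℕ : ℕ → Carrier
  fromℕ zero    = 0#
  fromℕ (suc n) = 1# + fromℕ n

  CharZero : Set ℓ
  CharZero = ∀ n → ¬ (fromℕ (suc n) ≈ 0#)

  -- polynomials in one variable as coefficient lists (constant term first)
  Poly : Set c
  Poly = List Carrier

  NonZeroPoly : Poly → Set (c ⊔ ℓ)
  NonZeroPoly p = Any (λ x → ¬ (x ≈ 0#)) p

record DiffField (c ℓ : Level) : Set (lsuc (c ⊔ ℓ)) where
  field
    field′ : Field c ℓ
  open Field field′ public
  field
    ∂        : Carrier → Carrier
    ∂-cong   : ∀ {x y} → x ≈ y → ∂ x ≈ ∂ y
    ∂-+      : ∀ x y → ∂ (x + y) ≈ ∂ x + ∂ y
    ∂-*      : ∀ x y → ∂ (x * y) ≈ ∂ x * y + x * ∂ y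

IsFieldHom : ∀ {k ℓk c ℓ} (K : Field k ℓk) (L : Field c ℓ) →
             (Field.Carrier K → Field.Carrier L) → Set (k ⊔ ℓk ⊔ ℓ)
IsFieldHom K L φ = RingMorphisms.IsRingHomomorphism
                     (Field.rawRing K) (Field.rawRing L) φ

module _ {k ℓk c ℓ} (K : Field k ℓk) (𝒦 : DiffField c ℓ)
         (φ : Field.Carrier K → DiffField.Carrier 𝒦) where
  open DiffField 𝒦

  evalAt : Field.Poly K → Carrier → Carrier
  evalAt []       z = 0#
  evalAt (a ∷ as) z = φ a + z * evalAt as z

  Transcendental : Carrier → Set (k ⊔ ℓk ⊔ ℓ)
  Transcendental z = ∀ (p : Field.Poly K) → Field.NonZeroPoly K p →
                     ¬ (evalAt p z ≈ 0#)

-- An operator Σ fᵢ ∂^i is the list f₀ ∷ f₁ ∷ …; it acts on 𝒦 and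
-- multiplication is composition (functions act by multiplication).
module DiffOps {c ℓ} (𝒦 : DiffField c ℓ) where
  open DiffField 𝒦

  Op : Set c
  Op = List Carrier

  coeff : Op → ℕ → Carrier
  coeff []       _       = 0#
  coeff (f ∷ fs) zero    = f
  coeff (f ∷ fs) (suc i) = coeff fs i

  infix 4 _≋_
  _≋_ : Op → Op → Set ℓ
  L ≋ M = ∀ i → coeff L i ≈ coeff M i

  infixl 6 _⊕_
  _⊕_ : Op → Op → Op
  []       ⊕ M        = M
  (f ∷ fs) ⊕ []       = f ∷ fs
  (f ∷ fs) ⊕ (g ∷ gs) = (f + g) ∷ (fs ⊕ gs)

  _·_ : Carrier → Op → Op
  f · []       = []
  f · (g ∷ gs) = (f * g) ∷ (f · gs)

  mapD : Op → Op
  mapD []       = []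
  mapD (g ∷ gs) = ∂ g ∷ mapD gs

  -- composition ∂ ∘ L :  ∂ (Σ gⱼ ∂^j) = Σ gⱼ' ∂^j + Σ gⱼ ∂^(j+1)
  ∂∘ : Op → Op
  ∂∘ L = mapD L ⊕ (0# ∷ L)

  infixl 7 _⊛_
  _⊛_ : Op → Op → Op
  []       ⊛ M = []
  (f ∷ fs) ⊛ M = (f · M) ⊕ (fs ⊛ ∂∘ M)

  ⟨_⟩ : Carrier → Op
  ⟨ f ⟩ = f ∷ []

  D : Op
  D = 0# ∷ 1# ∷ []

  oneOp : Op
  oneOp = ⟨ 1# ⟩

  infixr 8 _^ᴼ_
  _^ᴼ_ : Op → ℕ → Op
  L ^ᴼ zero  = oneOp
  L ^ᴼ suc n = L ⊛ (L ^ᴼ n)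

  prodUpTo : ℕ → (ℕ → Op) → Op
  prodUpTo zero    F = oneOp
  prodUpTo (suc n) F = prodUpTo n F ⊛ F n

  _^_ : Carrier → ℕ → Carrier
  x ^ zero  = 1#
  x ^ suc n = x * (x ^ n)

  invFact : ℕ → Carrier
  invFact n = fromℕ (n !) ⁻¹

  R : (a b c : Carrier) → ℕ → Op
  R a b c n = invFact n · ((D ⊕ ⟨ b * a ⁻¹ ⟩) ^ᴼ n ⊛ ⟨ c ^ n ⟩)

-- With β = b/a the equation says ∂w = βw, i.e. w ∘ (∂ + β) = ∂ ∘ w as operators,
-- so (∂ + β)ⁿ = w⁻¹ ∂ⁿ w by conjugation. For the product, Leibniz gives
-- (∂ + β) ∘ c^(k+1) = c^k ∘ ((∂ + β) ∘ c + k c′) = c^k ∘ (R₁ + k c′), and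
-- peeling off one factor of (∂ + β) at a time turns (∂ + β)ⁿ ∘ cⁿ into the
-- ordered product of the R₁ + k c′.
module Submission where

open import Defs
open import Data.Nat using (ℕ; zero; suc)
open import Data.Product using (_×_; _,_)
open import Data.List using ([]; _∷_)
open import Relation.Nullary using (¬_)
open import Relation.Binary.Bundles using (Setoid)
open import Algebra.Bundles using (CommutativeMonoid)
import Algebra.Properties.CommutativeSemigroup as CommutativeSemigroupProperties
import Algebra.Properties.Ring as RingProperties
import Algebra.Solver.Ring.NaturalCoefficients.Default as NaturalSolver
import Relation.Binary.Reasoning.Setoid as SetoidReasoning

module DerivationProperties {c ℓ} (𝒦 : DiffField c ℓ) where
  open DiffField 𝒦 hiding (zero)
  open DiffOps 𝒦 using (_^_)
  open RingProperties ring using (x+x≈x⇒x≈0; +-inverseʳ-unique; -‿involutive; -‿distribˡ-*)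
  open NaturalSolver commutativeSemiring using (solve; _:=_; _:+_; _:*_)
  open SetoidReasoning setoid

  ∂-0# : ∂ 0# ≈ 0#
  ∂-0# = x+x≈x⇒x≈0 (∂ 0#) (trans (sym (∂-+ 0# 0#)) (∂-cong (+-identityˡ 0#)))

  ∂-1# : ∂ 1# ≈ 0#
  ∂-1# = x+x≈x⇒x≈0 (∂ 1#) (begin
    ∂ 1# + ∂ 1#            ≈⟨ +-cong (*-identityʳ _) (*-identityˡ _) ⟨
    ∂ 1# * 1# + 1# * ∂ 1#  ≈⟨ ∂-* 1# 1# ⟨
    ∂ (1# * 1#)            ≈⟨ ∂-cong (*-identityˡ 1#) ⟩
    ∂ 1#                   ∎)

  fromℕ-suc-* : ∀ n y → fromℕ (suc n) * y ≈ y + fromℕ n * y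
  fromℕ-suc-* n y = trans (distribʳ y 1# (fromℕ n)) (+-congʳ (*-identityˡ y))

  ∂-^ : ∀ x k → ∂ (x ^ suc k) ≈ fromℕ (suc k) * (x ^ k * ∂ x)
  ∂-^ x zero = begin
    ∂ (x * 1#)                  ≈⟨ ∂-* x 1# ⟩
    ∂ x * 1# + x * ∂ 1#         ≈⟨ +-cong (*-identityʳ _) (trans (*-congˡ ∂-1#) (zeroʳ x)) ⟩
    ∂ x + 0#                    ≈⟨ +-cong (*-identityˡ _) (zeroˡ _) ⟨
    1# * ∂ x + 0# * (1# * ∂ x)  ≈⟨ fromℕ-suc-* zero (1# * ∂ x) ⟨
    fromℕ 1 * (1# * ∂ x)        ∎
  ∂-^ x (suc k) = begin
    ∂ (x * x ^ suc k)                                        ≈⟨ ∂-* x (x ^ suc k) ⟩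
    ∂ x * x ^ suc k + x * ∂ (x ^ suc k)                      ≈⟨ +-congˡ (*-congˡ (∂-^ x k)) ⟩
    ∂ x * (x * x ^ k) + x * (fromℕ (suc k) * (x ^ k * ∂ x))  ≈⟨ solve 4
      (λ d y p n → d :* (y :* p) :+ y :* (n :* (p :* d)) := (y :* p) :* d :+ n :* ((y :* p) :* d))
      refl (∂ x) x (x ^ k) (fromℕ (suc k)) ⟩
    x ^ suc k * ∂ x + fromℕ (suc k) * (x ^ suc k * ∂ x)      ≈⟨ fromℕ-suc-* (suc k) _ ⟨
    fromℕ (suc (suc k)) * (x ^ suc k * ∂ x)                  ∎

  -a∂w+bw≈0⇒∂w≈ba⁻¹w : ∀ {a b w} → ¬ (a ≈ 0#) → (- a) * ∂ w + b * w ≈ 0# → ∂ w ≈ (b * a ⁻¹) * w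
  -a∂w+bw≈0⇒∂w≈ba⁻¹w {a} {b} {w} a≉0 ode = begin
    ∂ w                 ≈⟨ *-identityˡ _ ⟨
    1# * ∂ w            ≈⟨ *-congʳ (⁻¹-inverse a a≉0) ⟨
    (a * a ⁻¹) * ∂ w    ≈⟨ solve 3 (λ a i d → (a :* i) :* d := i :* (a :* d)) refl a (a ⁻¹) (∂ w) ⟩
    a ⁻¹ * (a * ∂ w)    ≈⟨ *-congˡ bw≈a∂w ⟨
    a ⁻¹ * (b * w)      ≈⟨ solve 3 (λ i b w → i :* (b :* w) := (b :* i) :* w) refl (a ⁻¹) b w ⟩
    (b * a ⁻¹) * w      ∎
    where
    bw≈a∂w : b * w ≈ a * ∂ w
    bw≈a∂w = begin
      b * w             ≈⟨ +-inverseʳ-unique _ _ ode ⟩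
      - ((- a) * ∂ w)   ≈⟨ -‿cong (-‿distribˡ-* a (∂ w)) ⟨
      - - (a * ∂ w)     ≈⟨ -‿involutive _ ⟩
      a * ∂ w           ∎

  x⁻¹*x≈1 : ∀ {x} → ¬ (x ≈ 0#) → x ⁻¹ * x ≈ 1#
  x⁻¹*x≈1 {x} x≉0 = trans (*-comm _ _) (⁻¹-inverse x x≉0)

  fromℕ-1⁻¹≈1 : fromℕ 1 ⁻¹ ≈ 1#
  fromℕ-1⁻¹≈1 = begin
    (1# + 0#) ⁻¹   ≈⟨ ⁻¹-cong (+-identityʳ 1#) ⟩
    1# ⁻¹          ≈⟨ *-identityˡ _ ⟨
    1# * 1# ⁻¹     ≈⟨ ⁻¹-inverse 1# 1≉0 ⟩
    1#             ∎

module OperatorAlgebra {c ℓ} (𝒦 : DiffField c ℓ) where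
  open DiffField 𝒦 hiding (zero)
  open DiffOps 𝒦
  open DerivationProperties 𝒦 using (∂-0#; ∂-1#)

  coeff-⊕ : ∀ L M i → coeff (L ⊕ M) i ≈ coeff L i + coeff M i
  coeff-⊕ []       M        i       = sym (+-identityˡ _)
  coeff-⊕ (f ∷ fs) []       i       = sym (+-identityʳ _)
  coeff-⊕ (f ∷ fs) (g ∷ gs) zero    = refl
  coeff-⊕ (f ∷ fs) (g ∷ gs) (suc i) = coeff-⊕ fs gs i

  coeff-· : ∀ f L i → coeff (f · L) i ≈ f * coeff L i
  coeff-· f []       i       = sym (zeroʳ f)
  coeff-· f (g ∷ gs) zero    = refl
  coeff-· f (g ∷ gs) (suc i) = coeff-· f gs i

  coeff-mapD : ∀ L i → coeff (mapD L) i ≈ ∂ (coeff L i)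
  coeff-mapD []       i       = sym ∂-0#
  coeff-mapD (g ∷ gs) zero    = refl
  coeff-mapD (g ∷ gs) (suc i) = coeff-mapD gs i

  -- L ≋ M is a Π-type, from which Agda cannot infer L and M; the record
  -- wrapper makes the operators inferable from proofs.
  infix 4 _≃_
  record _≃_ (L M : Op) : Set ℓ where
    constructor coeffwise
    field ≃⇒≋ : L ≋ M
  open _≃_ public

  ≃-refl : ∀ {L} → L ≃ L
  ≃-refl = coeffwise λ i → refl

  ≃-sym : ∀ {L M} → L ≃ M → M ≃ L
  ≃-sym (coeffwise p) = coeffwise λ i → sym (p i)

  ≃-trans : ∀ {L M N} → L ≃ M → M ≃ N → L ≃ N
  ≃-trans (coeffwise p) (coeffwise q) = coeffwise λ i → trans (p i) (q i)

  ≃-setoid : Setoid c ℓ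
  ≃-setoid = record
    { Carrier = Op ; _≈_ = _≃_
    ; isEquivalence = record { refl = ≃-refl ; sym = ≃-sym ; trans = ≃-trans } }

  ∷-cong : ∀ {x y L M} → x ≈ y → L ≃ M → (x ∷ L) ≃ (y ∷ M)
  ∷-cong x≈y (coeffwise p) = coeffwise λ { zero → x≈y ; (suc i) → p i }

  ⟨⟩-cong : ∀ {f g} → f ≈ g → ⟨ f ⟩ ≃ ⟨ g ⟩
  ⟨⟩-cong f≈g = ∷-cong f≈g ≃-refl

  ⊕-cong : ∀ {L L′ M M′} → L ≃ L′ → M ≃ M′ → (L ⊕ M) ≃ (L′ ⊕ M′)
  ⊕-cong {L} {L′} {M} {M′} (coeffwise p) (coeffwise q) = coeffwise λ i →
    trans (coeff-⊕ L M i) (trans (+-cong (p i) (q i)) (sym (coeff-⊕ L′ M′ i)))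

  ·-cong : ∀ {f g L M} → f ≈ g → L ≃ M → (f · L) ≃ (g · M)
  ·-cong {f} {g} {L} {M} f≈g (coeffwise p) = coeffwise λ i →
    trans (coeff-· f L i) (trans (*-cong f≈g (p i)) (sym (coeff-· g M i)))

  ∂∘-cong : ∀ {L M} → L ≃ M → ∂∘ L ≃ ∂∘ M
  ∂∘-cong {L} {M} (coeffwise p) = ⊕-cong mapD-cong (∷-cong refl (coeffwise p))
    where
    mapD-cong : mapD L ≃ mapD M
    mapD-cong = coeffwise λ i →
      trans (coeff-mapD L i) (trans (∂-cong (p i)) (sym (coeff-mapD M i)))

  ⊕-commutativeMonoid : CommutativeMonoid c ℓ
  ⊕-commutativeMonoid = record
    { Carrier = Op ; _≈_ = _≃_ ; _∙_ = _⊕_ ; ε = []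
    ; isCommutativeMonoid = record
      { isMonoid = record
        { isSemigroup = record
          { isMagma = record
            { isEquivalence = Setoid.isEquivalence ≃-setoid ; ∙-cong = ⊕-cong }
          ; assoc = ⊕-assoc }
        ; identity = (λ L → ≃-refl) , ⊕-identityʳ }
      ; comm = ⊕-comm } }
    where
    ⊕-assoc : ∀ L M N → ((L ⊕ M) ⊕ N) ≃ (L ⊕ (M ⊕ N))
    ⊕-assoc L M N = coeffwise λ i →
      trans (coeff-⊕ (L ⊕ M) N i) (trans (+-congʳ (coeff-⊕ L M i)) (trans (+-assoc _ _ _)
        (sym (trans (coeff-⊕ L (M ⊕ N) i) (+-congˡ (coeff-⊕ M N i))))))
    ⊕-identityʳ : ∀ L → (L ⊕ []) ≃ L
    ⊕-identityʳ L = coeffwise λ i → trans (coeff-⊕ L [] i) (+-identityʳ _)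
    ⊕-comm : ∀ L M → (L ⊕ M) ≃ (M ⊕ L)
    ⊕-comm L M = coeffwise λ i →
      trans (coeff-⊕ L M i) (trans (+-comm _ _) (sym (coeff-⊕ M L i)))

  open CommutativeMonoid ⊕-commutativeMonoid public
    using () renaming (assoc to ⊕-assoc; identityʳ to ⊕-identityʳ)
  open CommutativeSemigroupProperties
         (CommutativeMonoid.commutativeSemigroup ⊕-commutativeMonoid)
    using () renaming (interchange to ⊕-interchange)

  open SetoidReasoning ≃-setoid

  ·-zeroˡ : ∀ L → (0# · L) ≃ []
  ·-zeroˡ L = coeffwise λ i → trans (coeff-· 0# L i) (zeroˡ _)

  ·-identityˡ : ∀ L → (1# · L) ≃ L
  ·-identityˡ L = coeffwise λ i → trans (coeff-· 1# L i) (*-identityˡ _)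

  ·-assoc : ∀ f g L → (f · (g · L)) ≃ ((f * g) · L)
  ·-assoc f g L = coeffwise λ i →
    trans (coeff-· f (g · L) i) (trans (*-congˡ (coeff-· g L i))
      (trans (sym (*-assoc _ _ _)) (sym (coeff-· (f * g) L i))))

  ·-distribˡ-⊕ : ∀ f L M → (f · (L ⊕ M)) ≃ ((f · L) ⊕ (f · M))
  ·-distribˡ-⊕ f L M = coeffwise λ i →
    trans (coeff-· f (L ⊕ M) i) (trans (*-congˡ (coeff-⊕ L M i)) (trans (distribˡ _ _ _)
      (sym (trans (coeff-⊕ (f · L) (f · M) i) (+-cong (coeff-· f L i) (coeff-· f M i))))))

  ·-distribʳ-+ : ∀ f g L → ((f + g) · L) ≃ ((f · L) ⊕ (g · L))
  ·-distribʳ-+ f g L = coeffwise λ i →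
    trans (coeff-· (f + g) L i) (trans (distribʳ _ _ _)
      (sym (trans (coeff-⊕ (f · L) (g · L) i) (+-cong (coeff-· f L i) (coeff-· g L i)))))

  ∂∘-⊕ : ∀ L M → ∂∘ (L ⊕ M) ≃ (∂∘ L ⊕ ∂∘ M)
  ∂∘-⊕ L M = begin
    mapD (L ⊕ M) ⊕ (0# ∷ (L ⊕ M))              ≈⟨ ⊕-cong mapD-⊕ (∷-cong (sym (+-identityʳ 0#)) ≃-refl) ⟩
    (mapD L ⊕ mapD M) ⊕ ((0# ∷ L) ⊕ (0# ∷ M))  ≈⟨ ⊕-interchange (mapD L) (mapD M) (0# ∷ L) (0# ∷ M) ⟩
    (mapD L ⊕ (0# ∷ L)) ⊕ (mapD M ⊕ (0# ∷ M))  ∎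
    where
    mapD-⊕ : mapD (L ⊕ M) ≃ (mapD L ⊕ mapD M)
    mapD-⊕ = coeffwise λ i →
      trans (coeff-mapD (L ⊕ M) i) (trans (∂-cong (coeff-⊕ L M i)) (trans (∂-+ _ _)
        (sym (trans (coeff-⊕ (mapD L) (mapD M) i) (+-cong (coeff-mapD L i) (coeff-mapD M i))))))

  ∂∘-· : ∀ f M → ∂∘ (f · M) ≃ ((∂ f · M) ⊕ (f · ∂∘ M))
  ∂∘-· f M = begin
    mapD (f · M) ⊕ (0# ∷ (f · M))                ≈⟨ ⊕-cong mapD-· (∷-cong (sym (zeroʳ f)) ≃-refl) ⟩
    ((∂ f · M) ⊕ (f · mapD M)) ⊕ (f · (0# ∷ M))  ≈⟨ ⊕-assoc (∂ f · M) (f · mapD M) (f · (0# ∷ M)) ⟩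
    (∂ f · M) ⊕ ((f · mapD M) ⊕ (f · (0# ∷ M)))  ≈⟨ ⊕-cong ≃-refl (·-distribˡ-⊕ f (mapD M) (0# ∷ M)) ⟨
    (∂ f · M) ⊕ (f · ∂∘ M)                       ∎
    where
    mapD-· : mapD (f · M) ≃ ((∂ f · M) ⊕ (f · mapD M))
    mapD-· = coeffwise λ i →
      trans (coeff-mapD (f · M) i) (trans (∂-cong (coeff-· f M i)) (trans (∂-* _ _)
        (sym (trans (coeff-⊕ (∂ f · M) (f · mapD M) i)
          (+-cong (coeff-· (∂ f) M i) (trans (coeff-· f (mapD M) i) (*-congˡ (coeff-mapD M i))))))))

  -- Operators whose coefficients all vanish need not be [], so the left
  -- congruence of ⊛ has to treat them separately.
  ⊛-zeroˡ : ∀ {L} M → L ≃ [] → (L ⊛ M) ≃ []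
  ⊛-zeroˡ {[]}     M L≃[] = ≃-refl
  ⊛-zeroˡ {f ∷ fs} M (coeffwise p) = begin
    (f · M) ⊕ (fs ⊛ ∂∘ M)  ≈⟨ ⊕-cong (≃-trans (·-cong (p zero) (≃-refl {M})) (·-zeroˡ M))
                                      (⊛-zeroˡ {fs} (∂∘ M) (coeffwise λ i → p (suc i))) ⟩
    [] ⊕ []                ∎

  ⊛-congˡ : ∀ {L L′} M → L ≃ L′ → (L ⊛ M) ≃ (L′ ⊛ M)
  ⊛-congˡ {[]}     {[]}     M L≃L′ = ≃-refl
  ⊛-congˡ {[]}     {g ∷ gs} M L≃L′ = ≃-sym (⊛-zeroˡ M (≃-sym L≃L′))
  ⊛-congˡ {f ∷ fs} {[]}     M L≃L′ = ⊛-zeroˡ M L≃L′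
  ⊛-congˡ {f ∷ fs} {g ∷ gs} M (coeffwise p) =
    ⊕-cong (·-cong (p zero) (≃-refl {M})) (⊛-congˡ {fs} {gs} (∂∘ M) (coeffwise λ i → p (suc i)))

  ⊛-congʳ : ∀ L {M M′} → M ≃ M′ → (L ⊛ M) ≃ (L ⊛ M′)
  ⊛-congʳ []       M≃M′ = ≃-refl
  ⊛-congʳ (f ∷ fs) M≃M′ = ⊕-cong (·-cong refl M≃M′) (⊛-congʳ fs (∂∘-cong M≃M′))

  ·-⊛ : ∀ f L M → ((f · L) ⊛ M) ≃ (f · (L ⊛ M))
  ·-⊛ f []       M = ≃-refl
  ·-⊛ f (g ∷ gs) M = begin
    ((f * g) · M) ⊕ ((f · gs) ⊛ ∂∘ M)  ≈⟨ ⊕-cong (≃-sym (·-assoc f g M)) (·-⊛ f gs (∂∘ M)) ⟩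
    (f · (g · M)) ⊕ (f · (gs ⊛ ∂∘ M))  ≈⟨ ·-distribˡ-⊕ f (g · M) (gs ⊛ ∂∘ M) ⟨
    f · ((g · M) ⊕ (gs ⊛ ∂∘ M))        ∎

  ⊛-distribʳ-⊕ : ∀ L L′ M → ((L ⊕ L′) ⊛ M) ≃ ((L ⊛ M) ⊕ (L′ ⊛ M))
  ⊛-distribʳ-⊕ []       L′       M = ≃-refl
  ⊛-distribʳ-⊕ (f ∷ fs) []       M = ≃-sym (⊕-identityʳ ((f ∷ fs) ⊛ M))
  ⊛-distribʳ-⊕ (f ∷ fs) (g ∷ gs) M = begin
    ((f + g) · M) ⊕ ((fs ⊕ gs) ⊛ ∂∘ M)
      ≈⟨ ⊕-cong (·-distribʳ-+ f g M) (⊛-distribʳ-⊕ fs gs (∂∘ M)) ⟩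
    ((f · M) ⊕ (g · M)) ⊕ ((fs ⊛ ∂∘ M) ⊕ (gs ⊛ ∂∘ M))
      ≈⟨ ⊕-interchange (f · M) (g · M) (fs ⊛ ∂∘ M) (gs ⊛ ∂∘ M) ⟩
    ((f · M) ⊕ (fs ⊛ ∂∘ M)) ⊕ ((g · M) ⊕ (gs ⊛ ∂∘ M))
      ∎

  ∂∘-⊛ : ∀ L M → ∂∘ (L ⊛ M) ≃ (∂∘ L ⊛ M)
  ∂∘-⊛ [] M = begin
    ∂∘ []           ≈⟨ coeffwise (λ { zero → refl ; (suc i) → refl }) ⟩
    []              ≈⟨ ·-zeroˡ M ⟨
    0# · M          ≈⟨ ⊕-identityʳ (0# · M) ⟨
    (0# · M) ⊕ []   ∎
  ∂∘-⊛ (g ∷ gs) M = begin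
    ∂∘ ((g · M) ⊕ (gs ⊛ ∂∘ M))
      ≈⟨ ∂∘-⊕ (g · M) (gs ⊛ ∂∘ M) ⟩
    ∂∘ (g · M) ⊕ ∂∘ (gs ⊛ ∂∘ M)
      ≈⟨ ⊕-cong (∂∘-· g M) (≃-trans (∂∘-⊛ gs (∂∘ M)) (⊛-distribʳ-⊕ (mapD gs) (0# ∷ gs) (∂∘ M))) ⟩
    ((∂ g · M) ⊕ (g · ∂∘ M)) ⊕ ((mapD gs ⊛ ∂∘ M) ⊕ ((0# · ∂∘ M) ⊕ (gs ⊛ ∂∘ (∂∘ M))))
      ≈⟨ ⊕-cong (≃-refl {(∂ g · M) ⊕ (g · ∂∘ M)})
           (⊕-cong (≃-refl {mapD gs ⊛ ∂∘ M}) (⊕-cong (·-zeroˡ (∂∘ M)) (≃-refl {gs ⊛ ∂∘ (∂∘ M)}))) ⟩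
    ((∂ g · M) ⊕ (g · ∂∘ M)) ⊕ ((mapD gs ⊛ ∂∘ M) ⊕ (gs ⊛ ∂∘ (∂∘ M)))
      ≈⟨ ⊕-interchange (∂ g · M) (g · ∂∘ M) (mapD gs ⊛ ∂∘ M) (gs ⊛ ∂∘ (∂∘ M)) ⟩
    ((∂ g · M) ⊕ (mapD gs ⊛ ∂∘ M)) ⊕ ((g · ∂∘ M) ⊕ (gs ⊛ ∂∘ (∂∘ M)))
      ≈⟨ ⊕-assoc (∂ g · M) (mapD gs ⊛ ∂∘ M) _ ⟩
    (∂ g · M) ⊕ ((mapD gs ⊛ ∂∘ M) ⊕ ((g · ∂∘ M) ⊕ (gs ⊛ ∂∘ (∂∘ M))))
      ≈⟨ ⊕-cong (·-cong (+-identityʳ _) ≃-refl) (⊛-distribʳ-⊕ (mapD gs) (g ∷ gs) (∂∘ M)) ⟨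
    ((∂ g + 0#) · M) ⊕ ((mapD gs ⊕ (g ∷ gs)) ⊛ ∂∘ M)
      ∎

  ⊛-assoc : ∀ L M N → ((L ⊛ M) ⊛ N) ≃ (L ⊛ (M ⊛ N))
  ⊛-assoc []       M N = ≃-refl
  ⊛-assoc (g ∷ gs) M N = begin
    ((g · M) ⊕ (gs ⊛ ∂∘ M)) ⊛ N         ≈⟨ ⊛-distribʳ-⊕ (g · M) (gs ⊛ ∂∘ M) N ⟩
    ((g · M) ⊛ N) ⊕ ((gs ⊛ ∂∘ M) ⊛ N)  ≈⟨ ⊕-cong (·-⊛ g M N) (⊛-assoc gs (∂∘ M) N) ⟩
    (g · (M ⊛ N)) ⊕ (gs ⊛ (∂∘ M ⊛ N))  ≈⟨ ⊕-cong ≃-refl (⊛-congʳ gs (∂∘-⊛ M N)) ⟨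
    (g · (M ⊛ N)) ⊕ (gs ⊛ ∂∘ (M ⊛ N))  ∎

  ⟨⟩-⊛ : ∀ f L → (⟨ f ⟩ ⊛ L) ≃ (f · L)
  ⟨⟩-⊛ f L = ⊕-identityʳ (f · L)

  ⊛-identityˡ : ∀ L → (oneOp ⊛ L) ≃ L
  ⊛-identityˡ L = ≃-trans (⟨⟩-⊛ 1# L) (·-identityˡ L)

  ⊛-0∷ : ∀ L M → (L ⊛ (0# ∷ M)) ≃ (0# ∷ (L ⊛ M))
  ⊛-0∷ []       M = coeffwise λ { zero → refl ; (suc i) → refl }
  ⊛-0∷ (g ∷ gs) M = begin
    (g · (0# ∷ M)) ⊕ (gs ⊛ ∂∘ (0# ∷ M))
      ≈⟨ ⊕-cong ≃-refl (⊛-congʳ gs (∷-cong (trans (+-identityʳ _) ∂-0#) ≃-refl)) ⟩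
    (g · (0# ∷ M)) ⊕ (gs ⊛ (0# ∷ ∂∘ M))        ≈⟨ ⊕-cong ≃-refl (⊛-0∷ gs (∂∘ M)) ⟩
    ((g * 0#) ∷ (g · M)) ⊕ (0# ∷ (gs ⊛ ∂∘ M))  ≈⟨ ∷-cong (trans (+-identityʳ _) (zeroʳ g)) ≃-refl ⟩
    0# ∷ ((g · M) ⊕ (gs ⊛ ∂∘ M))               ∎

  ⊛-identityʳ : ∀ L → (L ⊛ oneOp) ≃ L
  ⊛-identityʳ []       = ≃-refl
  ⊛-identityʳ (g ∷ gs) = begin
    (g · oneOp) ⊕ (gs ⊛ ∂∘ oneOp)
      ≈⟨ ⊕-cong ≃-refl (⊛-congʳ gs (∷-cong (trans (+-identityʳ _) ∂-1#) ≃-refl)) ⟩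
    (g · oneOp) ⊕ (gs ⊛ (0# ∷ oneOp))
      ≈⟨ ⊕-cong ≃-refl (≃-trans (⊛-0∷ gs oneOp) (∷-cong refl (⊛-identityʳ gs))) ⟩
    ((g * 1#) ∷ []) ⊕ (0# ∷ gs)        ≈⟨ ∷-cong (trans (+-identityʳ _) (*-identityʳ g)) ≃-refl ⟩
    g ∷ gs                             ∎

  intertwine-^ᴼ : ∀ {X L M} → (X ⊛ L) ≃ (M ⊛ X) → ∀ n → (X ⊛ L ^ᴼ n) ≃ (M ^ᴼ n ⊛ X)
  intertwine-^ᴼ {X} {L} {M} XL≃MX zero = ≃-trans (⊛-identityʳ X) (≃-sym (⊛-identityˡ X))
  intertwine-^ᴼ {X} {L} {M} XL≃MX (suc n) = begin
    X ⊛ (L ⊛ L ^ᴼ n)    ≈⟨ ⊛-assoc X L (L ^ᴼ n) ⟨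
    (X ⊛ L) ⊛ L ^ᴼ n    ≈⟨ ⊛-congˡ (L ^ᴼ n) XL≃MX ⟩
    (M ⊛ X) ⊛ L ^ᴼ n    ≈⟨ ⊛-assoc M X (L ^ᴼ n) ⟩
    M ⊛ (X ⊛ L ^ᴼ n)    ≈⟨ ⊛-congʳ M (intertwine-^ᴼ XL≃MX n) ⟩
    M ⊛ (M ^ᴼ n ⊛ X)    ≈⟨ ⊛-assoc M (M ^ᴼ n) X ⟨
    (M ⊛ M ^ᴼ n) ⊛ X    ∎

  ^ᴼ-suc : ∀ L n → (L ^ᴼ suc n) ≃ ((L ^ᴼ n) ⊛ L)
  ^ᴼ-suc L zero    = ≃-trans (⊛-identityʳ L) (≃-sym (⊛-identityˡ L))
  ^ᴼ-suc L (suc n) = begin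
    L ⊛ (L ⊛ (L ^ᴼ n))  ≈⟨ ⊛-congʳ L (^ᴼ-suc L n) ⟩
    L ⊛ ((L ^ᴼ n) ⊛ L)  ≈⟨ ⊛-assoc L (L ^ᴼ n) L ⟨
    (L ⊛ (L ^ᴼ n)) ⊛ L  ∎

module FirstOrderOperators {c ℓ} (𝒦 : DiffField c ℓ) where
  open DiffField 𝒦 hiding (zero)
  open DiffOps 𝒦
  open DerivationProperties 𝒦
  open OperatorAlgebra 𝒦
  open SetoidReasoning ≃-setoid

  D⊕⟨β⟩⊛⟨g⟩ : ∀ β g → ((D ⊕ ⟨ β ⟩) ⊛ ⟨ g ⟩) ≃ ((∂ g + β * g) ∷ g ∷ [])
  D⊕⟨β⟩⊛⟨g⟩ β g = ∷-cong coeff₀ (∷-cong (*-identityˡ g) ≃-refl)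
    where
    coeff₀ : (0# + β) * g + 1# * (∂ g + 0#) ≈ ∂ g + β * g
    coeff₀ = trans (+-cong (*-congʳ (+-identityˡ β)) (trans (*-identityˡ _) (+-identityʳ _)))
                   (+-comm _ _)

  ⟨w⟩⊛D⊕⟨β⟩ : ∀ {β w} → ∂ w ≈ β * w → (⟨ w ⟩ ⊛ (D ⊕ ⟨ β ⟩)) ≃ (D ⊛ ⟨ w ⟩)
  ⟨w⟩⊛D⊕⟨β⟩ {β} {w} ∂w≈βw = ∷-cong coeff₀ (∷-cong (*-comm w 1#) ≃-refl)
    where
    coeff₀ : w * (0# + β) ≈ 0# * w + 1# * (∂ w + 0#)
    coeff₀ = trans (*-congˡ (+-identityˡ β)) (trans (*-comm w β) (trans (sym ∂w≈βw)
               (sym (trans (+-cong (zeroˡ w) (trans (*-identityˡ _) (+-identityʳ _))) (+-identityˡ _)))))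

  [D⊕⟨β⟩]^ᴼ-conjugate : ∀ {β w} → ∂ w ≈ β * w → ¬ (w ≈ 0#) → ∀ n g →
                         ((D ⊕ ⟨ β ⟩) ^ᴼ n ⊛ ⟨ g ⟩) ≃ (⟨ w ⁻¹ ⟩ ⊛ D ^ᴼ n ⊛ ⟨ w * g ⟩)
  [D⊕⟨β⟩]^ᴼ-conjugate {β} {w} ∂w≈βw w≉0 n g = ≃-sym (begin
    (⟨ w ⁻¹ ⟩ ⊛ D ^ᴼ n) ⊛ (⟨ w ⟩ ⊛ ⟨ g ⟩)    ≈⟨ ⊛-assoc ⟨ w ⁻¹ ⟩ (D ^ᴼ n) (⟨ w ⟩ ⊛ ⟨ g ⟩) ⟩
    ⟨ w ⁻¹ ⟩ ⊛ (D ^ᴼ n ⊛ (⟨ w ⟩ ⊛ ⟨ g ⟩))    ≈⟨ ≃-sym (⊛-congʳ ⟨ w ⁻¹ ⟩ (⊛-assoc (D ^ᴼ n) ⟨ w ⟩ ⟨ g ⟩)) ⟩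
    ⟨ w ⁻¹ ⟩ ⊛ ((D ^ᴼ n ⊛ ⟨ w ⟩) ⊛ ⟨ g ⟩)    ≈⟨ ≃-sym (⊛-congʳ ⟨ w ⁻¹ ⟩ (⊛-congˡ ⟨ g ⟩ w-intertwines)) ⟩
    ⟨ w ⁻¹ ⟩ ⊛ ((⟨ w ⟩ ⊛ E ^ᴼ n) ⊛ ⟨ g ⟩)    ≈⟨ ⊛-congʳ ⟨ w ⁻¹ ⟩ (⊛-assoc ⟨ w ⟩ (E ^ᴼ n) ⟨ g ⟩) ⟩
    ⟨ w ⁻¹ ⟩ ⊛ (⟨ w ⟩ ⊛ (E ^ᴼ n ⊛ ⟨ g ⟩))    ≈⟨ ≃-sym (⊛-assoc ⟨ w ⁻¹ ⟩ ⟨ w ⟩ (E ^ᴼ n ⊛ ⟨ g ⟩)) ⟩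
    (⟨ w ⁻¹ ⟩ ⊛ ⟨ w ⟩) ⊛ (E ^ᴼ n ⊛ ⟨ g ⟩)    ≈⟨ ⊛-congˡ (E ^ᴼ n ⊛ ⟨ g ⟩) (⟨⟩-cong (x⁻¹*x≈1 w≉0)) ⟩
    oneOp ⊛ (E ^ᴼ n ⊛ ⟨ g ⟩)                 ≈⟨ ⊛-identityˡ (E ^ᴼ n ⊛ ⟨ g ⟩) ⟩
    E ^ᴼ n ⊛ ⟨ g ⟩                           ∎)
    where
    E = D ⊕ ⟨ β ⟩
    w-intertwines : (⟨ w ⟩ ⊛ E ^ᴼ n) ≃ (D ^ᴼ n ⊛ ⟨ w ⟩)
    w-intertwines = intertwine-^ᴼ (⟨w⟩⊛D⊕⟨β⟩ ∂w≈βw) n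

  module _ (a b c : Carrier) where
    private
      β = b * a ⁻¹
      E = D ⊕ ⟨ β ⟩
      F : ℕ → Op
      F j = R a b c 1 ⊕ ⟨ fromℕ j * ∂ c ⟩

    R₁≃[D⊕⟨β⟩]⊛⟨c⟩ : R a b c 1 ≃ (E ⊛ ⟨ c ⟩)
    R₁≃[D⊕⟨β⟩]⊛⟨c⟩ = begin
      invFact 1 · ((E ⊛ oneOp) ⊛ ⟨ c ^ 1 ⟩)  ≈⟨ ·-cong fromℕ-1⁻¹≈1 ≃-refl ⟩
      1# · ((E ⊛ oneOp) ⊛ ⟨ c ^ 1 ⟩)         ≈⟨ ·-identityˡ _ ⟩
      (E ⊛ oneOp) ⊛ ⟨ c ^ 1 ⟩                ≈⟨ ⊛-congˡ ⟨ c ^ 1 ⟩ (⊛-identityʳ E) ⟩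
      E ⊛ ⟨ c ^ 1 ⟩                          ≈⟨ ⊛-congʳ E (⟨⟩-cong (*-identityʳ c)) ⟩
      E ⊛ ⟨ c ⟩                              ∎

    ⟨c^k⟩⊛[R₁⊕⟨kc′⟩] : ∀ k → (⟨ c ^ k ⟩ ⊛ F k) ≃ (E ⊛ ⟨ c ^ suc k ⟩)
    ⟨c^k⟩⊛[R₁⊕⟨kc′⟩] k = begin
      ⟨ c ^ k ⟩ ⊛ F k
        ≈⟨ ⟨⟩-⊛ (c ^ k) (F k) ⟩
      (c ^ k) · F k
        ≈⟨ ·-cong refl (⊕-cong (≃-trans R₁≃[D⊕⟨β⟩]⊛⟨c⟩ (D⊕⟨β⟩⊛⟨g⟩ β c)) (≃-refl {⟨ fromℕ k * ∂ c ⟩})) ⟩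
      (c ^ k) · (((∂ c + β * c) + fromℕ k * ∂ c) ∷ c ∷ [])
        ≈⟨ ∷-cong coeff₀ (∷-cong (*-comm _ _) ≃-refl) ⟩
      (∂ (c ^ suc k) + β * c ^ suc k) ∷ c ^ suc k ∷ []
        ≈⟨ ≃-sym (D⊕⟨β⟩⊛⟨g⟩ β (c ^ suc k)) ⟩
      E ⊛ ⟨ c ^ suc k ⟩
        ∎
      where
      open NaturalSolver commutativeSemiring using (solve; _:=_; _:+_; _:*_)
      coeff₀ : c ^ k * ((∂ c + β * c) + fromℕ k * ∂ c) ≈ ∂ (c ^ suc k) + β * c ^ suc k
      coeff₀ = trans (solve 5 (λ P d b y n → P :* ((d :+ b :* y) :+ n :* d)
                                              := (P :* d :+ n :* (P :* d)) :+ b :* (y :* P))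
                             refl (c ^ k) (∂ c) β c (fromℕ k))
                     (+-congʳ (trans (sym (fromℕ-suc-* k _)) (sym (∂-^ c k))))

    [D⊕⟨β⟩]^ᴼ⊛⟨c^n⟩ : ∀ n → (E ^ᴼ n ⊛ ⟨ c ^ n ⟩) ≃ prodUpTo n F
    [D⊕⟨β⟩]^ᴼ⊛⟨c^n⟩ zero    = ⊛-identityˡ oneOp
    [D⊕⟨β⟩]^ᴼ⊛⟨c^n⟩ (suc k) = begin
      (E ⊛ E ^ᴼ k) ⊛ ⟨ c ^ suc k ⟩    ≈⟨ ⊛-congˡ ⟨ c ^ suc k ⟩ (^ᴼ-suc E k) ⟩
      (E ^ᴼ k ⊛ E) ⊛ ⟨ c ^ suc k ⟩    ≈⟨ ⊛-assoc (E ^ᴼ k) E ⟨ c ^ suc k ⟩ ⟩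
      E ^ᴼ k ⊛ (E ⊛ ⟨ c ^ suc k ⟩)    ≈⟨ ≃-sym (⊛-congʳ (E ^ᴼ k) (⟨c^k⟩⊛[R₁⊕⟨kc′⟩] k)) ⟩
      E ^ᴼ k ⊛ (⟨ c ^ k ⟩ ⊛ F k)      ≈⟨ ≃-sym (⊛-assoc (E ^ᴼ k) ⟨ c ^ k ⟩ (F k)) ⟩
      (E ^ᴼ k ⊛ ⟨ c ^ k ⟩) ⊛ F k      ≈⟨ ⊛-congˡ (F k) ([D⊕⟨β⟩]^ᴼ⊛⟨c^n⟩ k) ⟩
      prodUpTo k F ⊛ F k              ∎

lemma4p3 : ∀ {k ℓk c ℓ} (K : Field k ℓk) (𝒦 : DiffField c ℓ)
  → Field.CharZero K
  → (φ : Field.Carrier K → DiffField.Carrier 𝒦)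
  → IsFieldHom K (DiffField.field′ 𝒦) φ
  → (∀ x → DiffField._≈_ 𝒦 (DiffField.∂ 𝒦 (φ x)) (DiffField.0# 𝒦))
  → (z : DiffField.Carrier 𝒦)
  → DiffField._≈_ 𝒦 (DiffField.∂ 𝒦 z) (DiffField.1# 𝒦)
  → Transcendental K 𝒦 φ z
  → (a b p q : Field.Poly K)
  → ¬ (DiffField._≈_ 𝒦 (evalAt K 𝒦 φ q z) (DiffField.0# 𝒦))
  → let open DiffField 𝒦
        open DiffOps 𝒦
        az = evalAt K 𝒦 φ a z
        bz = evalAt K 𝒦 φ b z
        cz = evalAt K 𝒦 φ p z * (evalAt K 𝒦 φ q z) ⁻¹
    in ¬ (az * cz ≈ 0#)
    → (w : Carrier)
    → ¬ (w ≈ 0#)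
    → (- az) * ∂ w + bz * w ≈ 0#
    → (n : ℕ)
    → (R az bz cz n ≋ invFact n · (⟨ w ⁻¹ ⟩ ⊛ D ^ᴼ n ⊛ ⟨ w * cz ^ n ⟩))
      × (R az bz cz n ≋ invFact n · prodUpTo n (λ j → R az bz cz 1 ⊕ ⟨ fromℕ j * ∂ cz ⟩))

-- Only a ≠ 0 (from a c ≠ 0), w ≠ 0 and the equation for w are needed: the
-- identities hold over any differential field, and both sides carry the same
-- factor 1/n! (junk when n! = 0, which characteristic 0 rules out).
lemma4p3 K 𝒦 _ φ _ _ z _ _ a b p q _ ac≉0 w w≉0 ode n =
    ≃⇒≋ (·-cong refl ([D⊕⟨β⟩]^ᴼ-conjugate ∂w≈βw w≉0 n (c ^ n)))
  , ≃⇒≋ (·-cong refl ([D⊕⟨β⟩]^ᴼ⊛⟨c^n⟩ a′ b′ c n))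
  where
  open DiffField 𝒦 hiding (zero)
  open DiffOps 𝒦 using (_^_)
  open OperatorAlgebra 𝒦 using (≃⇒≋; ·-cong)
  open FirstOrderOperators 𝒦
  a′ = evalAt K 𝒦 φ a z
  b′ = evalAt K 𝒦 φ b z
  c = evalAt K 𝒦 φ p z * evalAt K 𝒦 φ q z ⁻¹
  a′≉0 : ¬ (a′ ≈ 0#)
  a′≉0 a′≈0 = ac≉0 (trans (*-congʳ a′≈0) (zeroˡ c))
  ∂w≈βw : ∂ w ≈ (b′ * a′ ⁻¹) * w
  ∂w≈βw = DerivationProperties.-a∂w+bw≈0⇒∂w≈ba⁻¹w 𝒦 a′≉0 ode
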